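{- Let $n\ge1$ and $m_i=2$ for all $i=1,\dots,n$. In the binary version of Algorithm WORK-AHEAD in which STEP omits the test whether $Q$ is full (described in the context), the queue $Q$ never holds more than $B':=\max\{\lceil (n+1)/2\rceil,2\}$ entries.
   Context: Binary Algorithm WORK-AHEAD without capacity test. Variables: $a_1,\dots,a_n$ all initially $0$; $d_1,\dots,d_n$ all initially $1$; $b_1,\dots,b_{n+1}$ all initially $0$; all radixes $m_1=\dots=m_{n+1}=2$; an (unbounded) FIFO queue $Q$, initially empty; an integer $j:=1$. Procedure STEP: if $b_j=1$, set $b_j:=0$ and $j:=j+1$; otherwise set $b_j:=b_j+1$, append $j$ to the back of $Q$, and set $j:=1$. Main loop, repeated: output $(a_n,\dots,a_1)$; call STEP; call STEP; remove the front entry $h$ of $Q$; if $h=n+1$, terminate; set $a_h:=a_h+d_h$; if $a_h=0$ or $a_h=m_h-1$, set $d_h:=-d_h$. -}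

module Defs where

open import Data.Nat using (ℕ; zero; suc; _+_; _≡ᵇ_; _⊔_; ⌈_/2⌉)
open import Data.Integer using (ℤ; +_; -_) renaming (_+_ to _+ℤ_)
import Data.Integer as ℤ
open import Data.Bool using (Bool; true; false; if_then_else_; _∨_)
open import Data.List using (List; []; _∷_; _++_; [_])
open import Data.Maybe using (Maybe; just; nothing; _>>=_)

-- functional update of an array indexed by ℕ (only indices 1..n+1 are used)
upd : {A : Set} → (ℕ → A) → ℕ → A → (ℕ → A)
upd f h v i = if i ≡ᵇ h then v else f i

data Phase : Set where
  step1 step2 remove halted : Phase

record Config : Set where
  constructor cfg
  field
    a  : ℕ → ℤ      -- a_1..a_n
    d  : ℕ → ℤ      -- d_1..d_n (values ±1)
    b  : ℕ → ℕ      -- b_1..b_{n+1}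
    Q  : List ℕ     -- FIFO queue; head = front, appended at the back
    j  : ℕ
    pc : Phase
open Config public

initial : Config
initial = cfg (λ _ → + 0) (λ _ → + 1) (λ _ → 0) [] 1 step1

-- procedure STEP (binary radix, no capacity test)
STEP : Config → Config
STEP c with b c (j c) ≡ᵇ 1
... | true  = record c { b = upd (b c) (j c) 0 ; j = suc (j c) }
... | false = record c { b = upd (b c) (j c) (suc (b c (j c)))
                       ; Q = Q c ++ [ j c ] ; j = 1 }

-- m_h = 2, so m_h - 1 = 1
isBoundary : ℤ → Bool
isBoundary x = ⌊ x ℤ.≟ + 0 ⌋ ∨ ⌊ x ℤ.≟ + 1 ⌋
  where open import Relation.Nullary.Decidable using (⌊_⌋)

-- one atomic transition of the main loop for parameter n;
-- nothing = no successor (halted, or removal from an empty queue)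
next : ℕ → Config → Maybe Config
next n c with pc c
... | step1  = just (record (STEP c) { pc = step2 })
... | step2  = just (record (STEP c) { pc = remove })
... | halted = nothing
... | remove with Q c
...   | [] = nothing
...   | h ∷ rest with h ≡ᵇ suc n
...     | true  = just (record c { Q = rest ; pc = halted })
...     | false =
          let ah = a c h +ℤ d c h
              dh = if isBoundary ah then - (d c h) else d c h
          in just (record c { Q = rest ; a = upd (a c) h ah
                            ; d = upd (d c) h dh ; pc = step1 })

run : ℕ → ℕ → Maybe Config
run n zero    = just initial
run n (suc k) = run n k >>= next n

B′ : ℕ → ℕ
B′ n = ⌈ suc n /2⌉ ⊔ 2

-- Let w be the number of set bits among b₁ … bₙ₊₁ and s the number of STEP calls
-- made so far in the current iteration (0, 1 or 2). A STEP either clears a bit, or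
-- sets one and enqueues an index, so w + s = 2|Q| holds throughout; the removal that
-- ends an iteration restores it after two steps. While bₙ₊₁ = 0 this gives
-- 2|Q| ≤ n + 2. Once n+1 has been enqueued, the bits below n+1 together with j are
-- bounded by one more than the number of entries queued behind n+1, and the balance
-- equation then forces |Q| ≤ 2.
module Submission where

open import Defs
open import Data.Nat using (ℕ; zero; suc; _+_; _*_; _≤_; _<_; _≡ᵇ_; z≤n; s≤s; ⌈_/2⌉)
open import Data.Nat.Properties
open import Data.Nat.Tactic.RingSolver using (solve-∀)
open import Data.List using (List; []; _∷_; _++_; [_]; length)
open import Data.List.Properties using (length-++; ++-assoc)
open import Data.Maybe using (just)
open import Data.Bool using (true; false; T)
open import Data.Product using (∃₂; _×_; _,_)
open import Data.Sum using (inj₁; inj₂)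
open import Relation.Nullary using (yes; no; contradiction)
open import Relation.Binary.PropositionalEquality hiding ([_])

upd-≡ : ∀ {A : Set} (f : ℕ → A) h v → upd f h v h ≡ v
upd-≡ f h v with h ≡ᵇ h in eq
... | true  = refl
... | false = contradiction (≡⇒≡ᵇ h h refl) (subst T eq)

upd-≢ : ∀ {A : Set} (f : ℕ → A) h v {i} → i ≢ h → upd f h v i ≡ f i
upd-≢ f h v {i} i≢h with i ≡ᵇ h in eq
... | true  = contradiction (≡ᵇ⇒≡ i h (subst T (sym eq) _)) i≢h
... | false = refl

upd-≤ : ∀ {f : ℕ → ℕ} {m} h {v} → (∀ i → f i ≤ m) → v ≤ m → ∀ i → upd f h v i ≤ m
upd-≤ h f≤m v≤m i with i ≡ᵇ h
... | true  = v≤m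
... | false = f≤m i

≤1∧≢1⇒≡0 : ∀ {x} → x ≤ 1 → x ≢ 1 → x ≡ 0
≤1∧≢1⇒≡0 x≤1 x≢1 with n≤1⇒n≡0∨n≡1 x≤1
... | inj₁ x≡0 = x≡0
... | inj₂ x≡1 = contradiction x≡1 x≢1

sumTo : (ℕ → ℕ) → ℕ → ℕ
sumTo f zero    = 0
sumTo f (suc k) = f (suc k) + sumTo f k

sumTo-upd-outside : ∀ f {h} v k → k < h → sumTo (upd f h v) k ≡ sumTo f k
sumTo-upd-outside f v zero    k<h = refl
sumTo-upd-outside f v (suc k) k<h =
  cong₂ _+_ (upd-≢ f _ v (<⇒≢ k<h)) (sumTo-upd-outside f v k (<-trans (n<1+n k) k<h))

sumTo-upd : ∀ f {h} v k → 1 ≤ h → h ≤ k → sumTo (upd f h v) k + f h ≡ sumTo f k + v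
sumTo-upd f v zero 1≤h h≤0 = contradiction (≤-trans 1≤h h≤0) λ ()
sumTo-upd f {h} v (suc k) 1≤h h≤1+k with suc k ≟ h
... | yes refl
  rewrite upd-≡ f (suc k) v | sumTo-upd-outside f v k (n<1+n k) = swap v (f (suc k)) (sumTo f k)
  where
  swap : ∀ x y z → x + z + y ≡ y + z + x
  swap = solve-∀
... | no 1+k≢h rewrite upd-≢ f h v 1+k≢h = begin
  f (suc k) + sumTo (upd f h v) k + f h    ≡⟨ +-assoc (f (suc k)) _ _ ⟩
  f (suc k) + (sumTo (upd f h v) k + f h)  ≡⟨ cong (f (suc k) +_) (sumTo-upd f v k 1≤h h≤k) ⟩
  f (suc k) + (sumTo f k + v)              ≡⟨ +-assoc (f (suc k)) _ _ ⟨
  f (suc k) + sumTo f k + v                ∎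
  where
  open ≡-Reasoning
  h≤k : h ≤ k
  h≤k = ≤-pred (≤∧≢⇒< h≤1+k (≢-sym 1+k≢h))

sumTo-zeros : ∀ f k → (∀ i → 1 ≤ i → i ≤ k → f i ≡ 0) → sumTo f k ≡ 0
sumTo-zeros f zero    _    = refl
sumTo-zeros f (suc k) f≡0 rewrite f≡0 (suc k) (s≤s z≤n) ≤-refl =
  sumTo-zeros f k λ i 1≤i i≤k → f≡0 i 1≤i (m≤n⇒m≤1+n i≤k)

sumTo-≤ : ∀ {f m} k → (∀ i → f i ≤ m) → sumTo f k ≤ k * m
sumTo-≤ zero    f≤m = z≤n
sumTo-≤ (suc k) f≤m = +-mono-≤ (f≤m (suc k)) (sumTo-≤ k f≤m)

-- s counts the STEP calls made since the last removal from Q.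
record Invariant (n s : ℕ) (b : ℕ → ℕ) (Q : List ℕ) (j : ℕ) : Set where
  field
    bits     : ∀ i → b i ≤ 1
    1≤j      : 1 ≤ j
    j≤1+n    : j ≤ suc n
    below-j  : ∀ i → 1 ≤ i → i < j → b i ≡ 0
    balance  : sumTo b (suc n) + s ≡ length Q + length Q
    overflow : b (suc n) ≡ 1 →
               ∃₂ λ xs ys → Q ≡ xs ++ suc n ∷ ys × sumTo b n + j ≤ suc (length ys)
open Invariant

initial-invariant : ∀ n → Invariant n 0 (λ _ → 0) [] 1
initial-invariant n = record
  { bits     = λ _ → z≤n
  ; 1≤j      = ≤-refl
  ; j≤1+n    = s≤s z≤n
  ; below-j  = λ i 1≤i i<1 → contradiction (≤-trans 1≤i (≤-pred i<1)) λ ()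
  ; balance  = trans (+-identityʳ _) (sumTo-zeros _ (suc n) λ _ _ _ → refl)
  ; overflow = λ ()
  }

overflow-arith : ∀ w s x y j → suc w + s ≡ (x + suc y) + (x + suc y) → w + j ≤ suc y →
                 x + x + y + j ≤ s
overflow-arith w s x y j balance w+j≤1+y = +-cancelʳ-≤ (suc (suc y)) _ _ (begin
  x + x + y + j + suc (suc y)    ≡⟨ regroup x y j ⟩
  (x + suc y) + (x + suc y) + j  ≡⟨ cong (_+ j) balance ⟨
  suc w + s + j                  ≡⟨ shift w s j ⟩
  s + suc (w + j)                ≤⟨ +-monoʳ-≤ s (s≤s w+j≤1+y) ⟩
  s + suc (suc y)                ∎)
  where
  open ≤-Reasoning
  regroup : ∀ x y j → x + x + y + j + suc (suc y) ≡ (x + suc y) + (x + suc y) + j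
  regroup = solve-∀
  shift : ∀ w s j → suc w + s + j ≡ s + suc (w + j)
  shift = solve-∀

overflow-split : ∀ {n s b Q j} → Invariant n s b Q j → b (suc n) ≡ 1 →
                 ∃₂ λ xs ys → Q ≡ xs ++ suc n ∷ ys ×
                              length xs + length xs + length ys + j ≤ s
overflow-split {n} {s} {b} {j = j} inv b₁₊ₙ≡1 with overflow inv b₁₊ₙ≡1
... | xs , ys , refl , w+j≤1+y =
  xs , ys , refl , overflow-arith (sumTo b n) s (length xs) (length ys) j balance′ w+j≤1+y
  where
  balance′ : suc (sumTo b n) + s ≡ (length xs + suc (length ys)) + (length xs + suc (length ys))
  balance′ = begin
    suc (sumTo b n) + s                 ≡⟨ cong (λ t → t + sumTo b n + s) b₁₊ₙ≡1 ⟨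
    sumTo b (suc n) + s                 ≡⟨ balance inv ⟩
    length (xs ++ suc n ∷ ys) + length (xs ++ suc n ∷ ys)
      ≡⟨ cong (λ l → l + l) (length-++ xs) ⟩
    (length xs + suc (length ys)) + (length xs + suc (length ys)) ∎
    where open ≡-Reasoning

carry-preserves : ∀ {n s b Q j} → 1 ≤ n → s ≤ 1 → Invariant n s b Q j → b j ≡ 1 →
                  Invariant n (suc s) (upd b j 0) Q (suc j)
carry-preserves {n} {s} {b} {Q} {j} 1≤n s≤1 inv bⱼ≡1 = record
  { bits     = upd-≤ j (bits inv) z≤n
  ; 1≤j      = s≤s z≤n
  ; j≤1+n    = s≤s j≤n
  ; below-j  = below-1+j
  ; balance  = trans (sym (+-assoc _ 1 s)) (trans (cong (_+ s) (cleared (suc n) (j≤1+n inv)))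
                                            (balance inv))
  ; overflow = overflow′
  }
  where
  -- If j = n+1 were set, then n+1 ≤ s ≤ 1 by overflow-split.
  j≢1+n : j ≢ suc n
  j≢1+n refl with overflow-split inv bⱼ≡1
  ... | xs , ys , _ , bound =
    contradiction (≤-trans (s≤s 1≤n) (≤-trans (m≤n+m (suc n) _) (≤-trans bound s≤1)))
                  λ { (s≤s ()) }

  j≤n : j ≤ n
  j≤n = ≤-pred (≤∧≢⇒< (j≤1+n inv) j≢1+n)

  cleared : ∀ k → j ≤ k → sumTo (upd b j 0) k + 1 ≡ sumTo b k
  cleared k j≤k = trans (cong (sumTo (upd b j 0) k +_) (sym bⱼ≡1))
                        (trans (sumTo-upd b 0 k (1≤j inv) j≤k) (+-identityʳ _))

  below-1+j : ∀ i → 1 ≤ i → i < suc j → upd b j 0 i ≡ 0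
  below-1+j i 1≤i i≤j with i ≟ j
  ... | yes refl = upd-≡ b j 0
  ... | no i≢j   = trans (upd-≢ b j 0 i≢j) (below-j inv i 1≤i (≤∧≢⇒< (≤-pred i≤j) i≢j))

  overflow′ : upd b j 0 (suc n) ≡ 1 → ∃₂ λ xs ys →
              Q ≡ xs ++ suc n ∷ ys × sumTo (upd b j 0) n + suc j ≤ suc (length ys)
  overflow′ b′₁₊ₙ≡1 with overflow inv (trans (sym (upd-≢ b j 0 (≢-sym j≢1+n))) b′₁₊ₙ≡1)
  ... | xs , ys , Q≡ , bound = xs , ys , Q≡ , ≤-trans (≤-reflexive same) bound
    where
    same : sumTo (upd b j 0) n + suc j ≡ sumTo b n + j
    same = trans (sym (+-assoc _ 1 j)) (cong (_+ j) (cleared n j≤n))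

push-preserves : ∀ {n s b Q j} → Invariant n s b Q j → b j ≡ 0 →
                 Invariant n (suc s) (upd b j 1) (Q ++ [ j ]) 1
push-preserves {n} {s} {b} {Q} {j} inv bⱼ≡0 = record
  { bits     = upd-≤ j (bits inv) ≤-refl
  ; 1≤j      = ≤-refl
  ; j≤1+n    = s≤s z≤n
  ; below-j  = λ i 1≤i i<1 → contradiction (≤-trans 1≤i (≤-pred i<1)) λ ()
  ; balance  = balance′
  ; overflow = overflow′
  }
  where
  set : ∀ k → j ≤ k → sumTo (upd b j 1) k ≡ sumTo b k + 1
  set k j≤k = trans (sym (+-identityʳ _))
                    (trans (cong (sumTo (upd b j 1) k +_) (sym bⱼ≡0))
                           (sumTo-upd b 1 k (1≤j inv) j≤k))

  balance′ : sumTo (upd b j 1) (suc n) + suc s ≡ length (Q ++ [ j ]) + length (Q ++ [ j ])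
  balance′ = begin
    sumTo (upd b j 1) (suc n) + suc s          ≡⟨ cong (_+ suc s) (set (suc n) (j≤1+n inv)) ⟩
    sumTo b (suc n) + 1 + suc s                ≡⟨ two-more (sumTo b (suc n)) s ⟩
    suc (suc (sumTo b (suc n) + s))            ≡⟨ cong (λ t → suc (suc t)) (balance inv) ⟩
    suc (suc (length Q + length Q))            ≡⟨ regroup (length Q) ⟩
    (length Q + 1) + (length Q + 1)            ≡⟨ cong (λ l → l + l) (length-++ Q) ⟨
    length (Q ++ [ j ]) + length (Q ++ [ j ])  ∎
    where
    open ≡-Reasoning
    two-more : ∀ x y → x + 1 + suc y ≡ suc (suc (x + y))
    two-more = solve-∀
    regroup : ∀ q → suc (suc (q + q)) ≡ (q + 1) + (q + 1)
    regroup = solve-∀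

  overflow′ : upd b j 1 (suc n) ≡ 1 → ∃₂ λ xs ys →
              Q ++ [ j ] ≡ xs ++ suc n ∷ ys × sumTo (upd b j 1) n + 1 ≤ suc (length ys)
  overflow′ b′₁₊ₙ≡1 with j ≟ suc n
  ... | yes refl = Q , [] , refl , ≤-reflexive (cong (_+ 1) (begin
    sumTo (upd b (suc n) 1) n  ≡⟨ sumTo-upd-outside b 1 n (n<1+n n) ⟩
    sumTo b n                  ≡⟨ sumTo-zeros b n (λ i 1≤i i≤n → below-j inv i 1≤i (s≤s i≤n)) ⟩
    0                          ∎))
    where open ≡-Reasoning
  ... | no j≢1+n with overflow inv (trans (sym (upd-≢ b j 1 (≢-sym j≢1+n))) b′₁₊ₙ≡1)
  ...   | xs , ys , refl , bound = xs , ys ++ [ j ] , ++-assoc xs (suc n ∷ ys) [ j ] , (begin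
    sumTo (upd b j 1) n + 1    ≡⟨ cong (_+ 1) (set n (≤-pred (≤∧≢⇒< (j≤1+n inv) j≢1+n))) ⟩
    sumTo b n + 1 + 1          ≤⟨ +-monoˡ-≤ 1 (+-monoʳ-≤ (sumTo b n) (1≤j inv)) ⟩
    sumTo b n + j + 1          ≤⟨ +-monoˡ-≤ 1 bound ⟩
    suc (length ys) + 1        ≡⟨ cong suc (length-++ ys) ⟨
    suc (length (ys ++ [ j ])) ∎)
    where open ≤-Reasoning

STEP-preserves : ∀ {n s} c → 1 ≤ n → s ≤ 1 → Invariant n s (b c) (Q c) (j c) →
                 Invariant n (suc s) (b (STEP c)) (Q (STEP c)) (j (STEP c))
STEP-preserves {n} {s} (cfg _ _ b Q j _) 1≤n s≤1 inv with b j ≡ᵇ 1 in bⱼ≡ᵇ1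
... | true  = carry-preserves 1≤n s≤1 inv (≡ᵇ⇒≡ (b j) 1 (subst T (sym bⱼ≡ᵇ1) _))
... | false = subst (λ v → Invariant n (suc s) (upd b j v) (Q ++ [ j ]) 1)
                    (cong suc (sym bⱼ≡0)) (push-preserves inv bⱼ≡0)
  where
  bⱼ≡0 : b j ≡ 0
  bⱼ≡0 = ≤1∧≢1⇒≡0 (bits inv j) λ bⱼ≡1 → subst T bⱼ≡ᵇ1 (≡⇒≡ᵇ (b j) 1 bⱼ≡1)

dequeue-preserves : ∀ {n b h Q j} → Invariant n 2 b (h ∷ Q) j → h ≢ suc n → Invariant n 0 b Q j
dequeue-preserves {n} {b} {h} {Q} {j} inv h≢1+n = record
  { bits     = bits inv
  ; 1≤j      = 1≤j inv
  ; j≤1+n    = j≤1+n inv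
  ; below-j  = below-j inv
  ; balance  = suc-injective (suc-injective (begin
      suc (suc (sumTo b (suc n) + 0))  ≡⟨ +0+2 (sumTo b (suc n)) ⟩
      sumTo b (suc n) + 2              ≡⟨ balance inv ⟩
      suc (length Q) + suc (length Q)  ≡⟨ cong suc (+-suc (length Q) (length Q)) ⟩
      suc (suc (length Q + length Q))  ∎))
  ; overflow = overflow′
  }
  where
  open ≡-Reasoning
  +0+2 : ∀ w → suc (suc (w + 0)) ≡ w + 2
  +0+2 = solve-∀

  overflow′ : b (suc n) ≡ 1 →
              ∃₂ λ xs ys → Q ≡ xs ++ suc n ∷ ys × sumTo b n + j ≤ suc (length ys)
  overflow′ b₁₊ₙ≡1 with overflow inv b₁₊ₙ≡1
  ... | []     , ys , refl , _     = contradiction refl h≢1+n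
  ... | _ ∷ xs , ys , refl , bound = xs , ys , refl , bound

overflow-queue-bound : ∀ {n s b Q j} → Invariant n s b Q j → s ≤ 2 → b (suc n) ≡ 1 →
                       length Q ≤ 2
overflow-queue-bound {j = j} inv s≤2 b₁₊ₙ≡1 with overflow-split inv b₁₊ₙ≡1
... | xs , ys , refl , bound = begin
  length (xs ++ _ ∷ ys)        ≡⟨ length-++ xs ⟩
  length xs + suc (length ys)  ≡⟨ +-suc (length xs) (length ys) ⟩
  suc (length xs + length ys)  ≡⟨ +-comm 1 _ ⟩
  length xs + length ys + 1
    ≤⟨ +-mono-≤ (+-monoˡ-≤ (length ys) (m≤m+n (length xs) _)) (1≤j inv) ⟩
  length xs + length xs + length ys + j ≤⟨ bound ⟩
  _                            ≤⟨ s≤2 ⟩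
  2                            ∎
  where open ≤-Reasoning

no-overflow-queue-bound : ∀ {n s b Q j} → Invariant n s b Q j → s ≤ 2 → b (suc n) ≡ 0 →
                          length Q ≤ ⌈ suc n /2⌉
no-overflow-queue-bound {n} {s} {b} {Q} inv s≤2 b₁₊ₙ≡0 =
  subst (_≤ ⌈ suc n /2⌉) (sym (n≡⌊n+n/2⌋ (length Q))) (⌊n/2⌋-mono twice≤)
  where
  open ≤-Reasoning
  twice≤ : length Q + length Q ≤ suc (suc n)
  twice≤ = begin
    length Q + length Q        ≡⟨ balance inv ⟨
    b (suc n) + sumTo b n + s  ≡⟨ cong (λ t → t + sumTo b n + s) b₁₊ₙ≡0 ⟩
    sumTo b n + s              ≤⟨ +-mono-≤ (sumTo-≤ n (bits inv)) s≤2 ⟩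
    n * 1 + 2                  ≡⟨ cong (_+ 2) (*-identityʳ n) ⟩
    n + 2                      ≡⟨ +-comm n 2 ⟩
    suc (suc n)                ∎

queue-bound : ∀ {n s b Q j} → Invariant n s b Q j → s ≤ 2 → length Q ≤ B′ n
queue-bound {n} {b = b} inv s≤2 with b (suc n) ≟ 1
... | yes b₁₊ₙ≡1 = ≤-trans (overflow-queue-bound inv s≤2 b₁₊ₙ≡1) (m≤n⊔m ⌈ suc n /2⌉ 2)
... | no  b₁₊ₙ≢1 = ≤-trans (no-overflow-queue-bound inv s≤2 (≤1∧≢1⇒≡0 (bits inv (suc n)) b₁₊ₙ≢1))
                           (m≤m⊔n ⌈ suc n /2⌉ 2)

PhaseInvariant : ℕ → Config → Set
PhaseInvariant n (cfg _ _ b Q j step1)  = Invariant n 0 b Q j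
PhaseInvariant n (cfg _ _ b Q j step2)  = Invariant n 1 b Q j
PhaseInvariant n (cfg _ _ b Q j remove) = Invariant n 2 b Q j
PhaseInvariant n (cfg _ _ _ Q _ halted) = length Q ≤ B′ n

phase-queue-bound : ∀ n c → PhaseInvariant n c → length (Q c) ≤ B′ n
phase-queue-bound n (cfg _ _ _ _ _ step1)  inv = queue-bound inv z≤n
phase-queue-bound n (cfg _ _ _ _ _ step2)  inv = queue-bound inv (s≤s z≤n)
phase-queue-bound n (cfg _ _ _ _ _ remove) inv = queue-bound inv ≤-refl
phase-queue-bound n (cfg _ _ _ _ _ halted) bnd = bnd

next-preserves : ∀ {n} → 1 ≤ n → ∀ c {c′} → PhaseInvariant n c → next n c ≡ just c′ →
                 PhaseInvariant n c′
next-preserves 1≤n c@(cfg _ _ _ _ _ step1) inv refl = STEP-preserves c 1≤n z≤n inv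
next-preserves 1≤n c@(cfg _ _ _ _ _ step2) inv refl = STEP-preserves c 1≤n (s≤s z≤n) inv
next-preserves 1≤n (cfg _ _ _ [] _ remove) inv ()
next-preserves {n} 1≤n (cfg _ _ _ (h ∷ _) _ remove) inv _ with h ≡ᵇ suc n in h≡ᵇ1+n
next-preserves 1≤n (cfg _ _ _ (h ∷ _) _ remove) inv refl | true  =
  ≤-trans (n≤1+n _) (queue-bound inv ≤-refl)
next-preserves 1≤n (cfg _ _ _ (h ∷ _) _ remove) inv refl | false =
  dequeue-preserves inv λ h≡1+n → subst T h≡ᵇ1+n (≡⇒≡ᵇ h _ h≡1+n)

run-invariant : ∀ {n} → 1 ≤ n → ∀ k {c} → run n k ≡ just c → PhaseInvariant n c
run-invariant {n} 1≤n zero    refl = initial-invariant n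
run-invariant {n} 1≤n (suc k) run≡ with run n k in run-k≡
... | just c = next-preserves 1≤n c (run-invariant 1≤n k run-k≡) run≡

lemma4 : (n : ℕ) → 1 ≤ n → (k : ℕ) (c : Config) →
         run n k ≡ just c → length (Config.Q c) ≤ B′ n
lemma4 n 1≤n k c run≡ = phase-queue-bound n c (run-invariant 1≤n k run≡)
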